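{- Let $(u_n)_{n\in\mathbb{N}}$ be the increasing sequence with $\{u_n:n\in\mathbb{N}\}=\{m\in\mathbb{N}: q_m=1\}$. Then $u_0=1$ and for all $n\in\mathbb{N}$, $$u_{2n}=4u_n-3,\qquad u_{2n+1}=4u_n-2.$$
   Context: The Baum--Sweet sequence $(b_n)$ is defined by $b_0=1$ and, for $n\ge1$, $b_n=0$ if the binary expansion of $n$ contains a maximal block of $0$'s of odd length, $b_n=1$ otherwise. Let $D=\sum_{n\ge0}b''_nX^n\in\mathbb{F}_2[[X]]$ with $b''_0=0$, $b''_n=b_{n-1}$ ($n\ge1$), and let $Q=\sum q_nX^n$ be its composition inverse in $\mathbb{F}_2[[X]]$ (the unique series with $D(Q(X))=Q(D(X))=X$). -}

module Defs where

open import Data.Bool using (Bool; true; false; not; _∧_; _xor_; if_then_else_)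
open import Data.Nat using (ℕ; zero; suc; _/_; _%_; _≡ᵇ_; _∸_)
open import Data.List using (List; []; _∷_)
open import Data.Bool.ListAction using (any)

-- Binary expansion (least significant digit first, true = 1).
-- For m ≥ 1 the last digit is the leading 1; bits 0 = [].
-- Fuel: the number of binary digits of m is at most m.

bitsF : ℕ → ℕ → List Bool
bitsF zero    _       = []
bitsF (suc f) zero    = []
bitsF (suc f) (suc m) = ((suc m % 2) ≡ᵇ 1) ∷ bitsF f (suc m / 2)

bits : ℕ → List Bool
bits m = bitsF m m

-- Lengths of the maximal blocks of 0's in a digit list
-- (k = length of the current run of 0's).
zeroBlocksFrom : ℕ → List Bool → List ℕ
zeroBlocksFrom zero    []            = []
zeroBlocksFrom (suc k) []            = suc k ∷ []
zeroBlocksFrom k       (false ∷ ds)  = zeroBlocksFrom (suc k) ds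
zeroBlocksFrom zero    (true ∷ ds)   = zeroBlocksFrom zero ds
zeroBlocksFrom (suc k) (true ∷ ds)   = suc k ∷ zeroBlocksFrom zero ds

zeroBlocks : List Bool → List ℕ
zeroBlocks = zeroBlocksFrom zero

isOdd : ℕ → Bool
isOdd k = (k % 2) ≡ᵇ 1

baumSweet : ℕ → Bool
baumSweet zero    = true
baumSweet (suc n) = not (any isOdd (zeroBlocks (bits (suc n))))

-- Formal power series over F₂ = Bool (xor = +, ∧ = ·).

Series : Set
Series = ℕ → Bool

xsum : ℕ → (ℕ → Bool) → Bool
xsum zero    f = f zero
xsum (suc n) f = xsum n f xor f (suc n)

_⊛_ : Series → Series → Series
(f ⊛ g) n = xsum n (λ i → f i ∧ g (n ∸ i))

oneS : Series
oneS zero    = true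
oneS (suc _) = false

Xs : Series
Xs (suc zero) = true
Xs _          = false

_^S_ : Series → ℕ → Series
f ^S zero  = oneS
f ^S suc k = f ⊛ (f ^S k)

-- Composition f(g(X)), meaningful when g 0 = false; then g^k has order ≥ k,
-- so the coefficient of X^m is the (finite) sum over k ≤ m of f_k [X^m] g^k.
_∘S_ : Series → Series → Series
(f ∘S g) m = xsum m (λ k → f k ∧ (g ^S k) m)

D : Series
D zero    = false
D (suc n) = baumSweet n

IsCompInverseOfD : Series → Set
IsCompInverseOfD Q = (Q 0 ≡ false) × (∀ m → (D ∘S Q) m ≡ Xs m) × (∀ m → (Q ∘S D) m ≡ Xs m)
  where
  open import Relation.Binary.PropositionalEquality using (_≡_)
  open import Data.Product using (_×_)

-- Over F₂ the series D = Σ bₙ₋₁Xⁿ satisfies X³D + X³D² + D⁴ = 0: coefficientwise this is the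
-- recursive description b₂ₙ₊₁ = bₙ, b₄ₙ = bₙ, b₄ₙ₊₂ = 0 of the Baum–Sweet sequence combined
-- with Frobenius, f(X)² = f(X²).  Composition with Q is a ring homomorphism and D ∘ Q = X, so
-- Q³X + Q³X² + X⁴ = 0.  Multiplying by Q and applying Frobenius once more gives
-- Q₄ₖ = Q₄ₖ₊₃ = 0 and Q₄ₖ₊₁ = Q₄ₖ₊₂ = Qₖ₊₁, with Q₁ = 1.  Hence Qₘ = 1 exactly when m − 1 has
-- all base-4 digits in {0, 1}, i.e. m = 1 + asBase4 n where asBase4 n reads the binary digits
-- of n in base 4.  This sequence is increasing, increasing enumerations of a set are unique,
-- and asBase4 (2n) = 4 asBase4 n, asBase4 (2n + 1) = 4 asBase4 n + 1 give the recurrences.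

module Submission where

open import Algebra using (CommutativeRing; CommutativeMonoid)
open import Data.Bool using (Bool; true; false; not; _∧_; _xor_)
open import Data.Bool.ListAction using (any)
open import Data.Bool.Properties
  using (xor-assoc; xor-comm; xor-same; xor-identityʳ; ∧-comm; ∧-assoc; ∧-idem; ∧-zeroʳ;
         ∧-distribˡ-xor; ∧-distribʳ-xor; xor-∧-commutativeRing; ∧-commutativeMonoid)
open import Data.Empty using (⊥-elim)
open import Data.List using (List; []; _∷_)
open import Data.Nat using (ℕ; zero; suc; _+_; _*_; _∸_; _≤_; _<_; z≤n; s≤s; z<s; _/_; _%_; _≡ᵇ_)
open import Data.Nat.DivMod using ([m+kn]%n≡m%n; m*n%n≡0; m*n/n≡m; m/n<m; +-distrib-/)
open import Data.Nat.Induction using (<-rec)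
open import Data.Nat.Properties
open import Data.Nat.Tactic.RingSolver using (solve-∀)
open import Data.Product using (_×_; _,_; ∃)
open import Data.Sum using (inj₁; inj₂)
open import Function.Bundles using (_⇔_; mk⇔; Equivalence)
open import Function.Construct.Composition using (_⇔-∘_)
open import Function.Construct.Symmetry using (⇔-sym)
open import Relation.Binary.PropositionalEquality
open import Relation.Nullary using (yes; no)
open import Algebra.Properties.CommutativeSemigroup
  (CommutativeRing.+-commutativeSemigroup xor-∧-commutativeRing)
  using () renaming (interchange to xor-interchange)
open import Algebra.Properties.CommutativeSemigroup
  (CommutativeMonoid.commutativeSemigroup ∧-commutativeMonoid)
  using () renaming (interchange to ∧-interchange)

open import Defs

xsum-cong-≤ : ∀ n {f g : ℕ → Bool} → (∀ i → i ≤ n → f i ≡ g i) → xsum n f ≡ xsum n g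
xsum-cong-≤ zero    f≡g = f≡g 0 z≤n
xsum-cong-≤ (suc n) f≡g =
  cong₂ _xor_ (xsum-cong-≤ n (λ i i≤n → f≡g i (m≤n⇒m≤1+n i≤n))) (f≡g (suc n) ≤-refl)

xsum-cong : ∀ n {f g : ℕ → Bool} → f ≗ g → xsum n f ≡ xsum n g
xsum-cong n f≗g = xsum-cong-≤ n (λ i _ → f≗g i)

xsum-xor : ∀ n (f g : ℕ → Bool) → xsum n (λ i → f i xor g i) ≡ xsum n f xor xsum n g
xsum-xor zero    f g = refl
xsum-xor (suc n) f g =
  trans (cong (_xor (f (suc n) xor g (suc n))) (xsum-xor n f g))
        (xor-interchange (xsum n f) (xsum n g) (f (suc n)) (g (suc n)))

xsum-∧ˡ : ∀ n b (f : ℕ → Bool) → b ∧ xsum n f ≡ xsum n (λ i → b ∧ f i)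
xsum-∧ˡ zero    b f = refl
xsum-∧ˡ (suc n) b f =
  trans (∧-distribˡ-xor b (xsum n f) (f (suc n))) (cong (_xor (b ∧ f (suc n))) (xsum-∧ˡ n b f))

xsum-∧ʳ : ∀ n b (f : ℕ → Bool) → xsum n f ∧ b ≡ xsum n (λ i → f i ∧ b)
xsum-∧ʳ n b f =
  trans (∧-comm (xsum n f) b) (trans (xsum-∧ˡ n b f) (xsum-cong n (λ i → ∧-comm b (f i))))

xsum-false : ∀ n (f : ℕ → Bool) → (∀ i → i ≤ n → f i ≡ false) → xsum n f ≡ false
xsum-false zero    f f≡0 = f≡0 0 z≤n
xsum-false (suc n) f f≡0 =
  cong₂ _xor_ (xsum-false n f (λ i i≤n → f≡0 i (m≤n⇒m≤1+n i≤n))) (f≡0 (suc n) ≤-refl)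

xsum-single : ∀ n (f : ℕ → Bool) {j} → j ≤ n → (∀ i → i ≢ j → f i ≡ false) → xsum n f ≡ f j
xsum-single zero    f z≤n others = refl
xsum-single (suc n) f j≤1+n others with m≤n⇒m<n∨m≡n j≤1+n
... | inj₁ j<1+n =
  trans (cong₂ _xor_ (xsum-single n f (≤-pred j<1+n) others)
                     (others (suc n) (λ 1+n≡j → <⇒≢ j<1+n (sym 1+n≡j))))
        (xor-identityʳ _)
... | inj₂ refl =
  cong (_xor f (suc n)) (xsum-false n f (λ i i≤n → others i (<⇒≢ (s≤s i≤n))))

xsum-unfoldˡ : ∀ n (f : ℕ → Bool) → xsum (suc n) f ≡ f 0 xor xsum n (λ i → f (suc i))
xsum-unfoldˡ zero    f = refl
xsum-unfoldˡ (suc n) f =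
  trans (cong (_xor f (suc (suc n))) (xsum-unfoldˡ n f)) (xor-assoc (f 0) _ _)

xsum-extend : ∀ {a b} (f : ℕ → Bool) → a ≤ b → (∀ l → a < l → f l ≡ false) → xsum b f ≡ xsum a f
xsum-extend {b = zero}  f z≤n    _      = refl
xsum-extend {a} {suc b} f a≤1+b vanish with m≤n⇒m<n∨m≡n a≤1+b
... | inj₁ a<1+b =
  trans (cong₂ _xor_ (xsum-extend f (≤-pred a<1+b) vanish) (vanish (suc b) a<1+b)) (xor-identityʳ _)
... | inj₂ refl = refl

xsum-swap : ∀ a b (f : ℕ → ℕ → Bool) →
  xsum a (λ i → xsum b (λ j → f i j)) ≡ xsum b (λ j → xsum a (λ i → f i j))
xsum-swap zero    b f = refl
xsum-swap (suc a) b f =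
  trans (cong (_xor xsum b (f (suc a))) (xsum-swap a b f))
        (sym (xsum-xor b (λ j → xsum a (λ i → f i j)) (f (suc a))))

xsum-reverse : ∀ n (f : ℕ → Bool) → xsum n f ≡ xsum n (λ i → f (n ∸ i))
xsum-reverse zero    f = refl
xsum-reverse (suc n) f =
  trans (cong (_xor f (suc n)) (xsum-reverse n f))
        (trans (xor-comm _ (f (suc n))) (sym (xsum-unfoldˡ n (λ i → f (suc n ∸ i)))))

xsum-triangle : ∀ n (f : ℕ → ℕ → Bool) →
  xsum n (λ k → xsum k (λ i → f i (k ∸ i))) ≡ xsum n (λ i → xsum (n ∸ i) (f i))
xsum-triangle zero    f = refl
xsum-triangle (suc n) f = begin
    xsum n (λ k → xsum k (λ i → f i (k ∸ i))) xor (xsum n diagonal xor f (suc n) (n ∸ n))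
  ≡⟨ cong₂ (λ s z → s xor (xsum n diagonal xor f (suc n) z)) (xsum-triangle n f) (n∸n≡0 n) ⟩
    rows xor (xsum n diagonal xor f (suc n) 0)
  ≡⟨ sym (xor-assoc rows (xsum n diagonal) _) ⟩
    (rows xor xsum n diagonal) xor f (suc n) 0
  ≡⟨ cong (_xor f (suc n) 0) (sym (xsum-xor n (λ i → xsum (n ∸ i) (f i)) diagonal)) ⟩
    xsum n (λ i → xsum (n ∸ i) (f i) xor f i (suc n ∸ i)) xor f (suc n) 0
  ≡⟨ cong (_xor f (suc n) 0) (xsum-cong-≤ n (λ i i≤n →
       trans (cong (λ z → xsum (n ∸ i) (f i) xor f i z) (+-∸-assoc 1 i≤n))
             (cong (λ z → xsum z (f i)) (sym (+-∸-assoc 1 i≤n))))) ⟩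
    xsum n (λ i → xsum (suc n ∸ i) (f i)) xor f (suc n) 0
  ≡⟨ cong (λ z → xsum n (λ i → xsum (suc n ∸ i) (f i)) xor xsum z (f (suc n))) (sym (n∸n≡0 n)) ⟩
    xsum (suc n) (λ i → xsum (suc n ∸ i) (f i))
  ∎
  where
  open ≡-Reasoning
  diagonal : ℕ → Bool
  diagonal i = f i (suc n ∸ i)
  rows : Bool
  rows = xsum n (λ i → xsum (n ∸ i) (f i))

zeroS : Series
zeroS _ = false

_⊕_ : Series → Series → Series
(f ⊕ g) n = f n xor g n

⊛-cong-≤ : ∀ {f f′ g g′} n → (∀ i → i ≤ n → f i ≡ f′ i) → (∀ i → i ≤ n → g i ≡ g′ i) →
  (f ⊛ g) n ≡ (f′ ⊛ g′) n
⊛-cong-≤ n f≡f′ g≡g′ = xsum-cong-≤ n (λ i i≤n → cong₂ _∧_ (f≡f′ i i≤n) (g≡g′ (n ∸ i) (m∸n≤m n i)))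

⊛-cong : ∀ {f f′ g g′} → f ≗ f′ → g ≗ g′ → f ⊛ g ≗ f′ ⊛ g′
⊛-cong f≗f′ g≗g′ n = ⊛-cong-≤ n (λ i _ → f≗f′ i) (λ i _ → g≗g′ i)

⊛-comm : ∀ f g → f ⊛ g ≗ g ⊛ f
⊛-comm f g n =
  trans (xsum-reverse n (λ i → f i ∧ g (n ∸ i)))
        (xsum-cong-≤ n (λ i i≤n → trans (cong (λ z → f (n ∸ i) ∧ g z) (m∸[m∸n]≡n i≤n))
                                        (∧-comm (f (n ∸ i)) (g i))))

⊛-assoc : ∀ f g h → (f ⊛ g) ⊛ h ≗ f ⊛ (g ⊛ h)
⊛-assoc f g h n = begin
    xsum n (λ k → xsum k (λ i → f i ∧ g (k ∸ i)) ∧ h (n ∸ k))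
  ≡⟨ xsum-cong n (λ k → xsum-∧ʳ k (h (n ∸ k)) (λ i → f i ∧ g (k ∸ i))) ⟩
    xsum n (λ k → xsum k (λ i → (f i ∧ g (k ∸ i)) ∧ h (n ∸ k)))
  ≡⟨ xsum-cong n (λ k → xsum-cong-≤ k (λ i i≤k →
       trans (∧-assoc (f i) (g (k ∸ i)) (h (n ∸ k)))
             (cong (λ z → f i ∧ (g (k ∸ i) ∧ h (n ∸ z))) (sym (m+[n∸m]≡n i≤k))))) ⟩
    xsum n (λ k → xsum k (λ i → term i (k ∸ i)))
  ≡⟨ xsum-triangle n term ⟩
    xsum n (λ i → xsum (n ∸ i) (term i))
  ≡⟨ xsum-cong n (λ i →
       trans (xsum-cong (n ∸ i) (λ j → cong (λ z → f i ∧ (g j ∧ h z)) (sym (∸-+-assoc n i j))))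
             (sym (xsum-∧ˡ (n ∸ i) (f i) (λ j → g j ∧ h (n ∸ i ∸ j))))) ⟩
    xsum n (λ i → f i ∧ xsum (n ∸ i) (λ j → g j ∧ h (n ∸ i ∸ j)))
  ∎
  where
  open ≡-Reasoning
  term : ℕ → ℕ → Bool
  term i j = f i ∧ (g j ∧ h (n ∸ (i + j)))

⊛-distribˡ-⊕ : ∀ f g h → f ⊛ (g ⊕ h) ≗ (f ⊛ g) ⊕ (f ⊛ h)
⊛-distribˡ-⊕ f g h n =
  trans (xsum-cong n (λ i → ∧-distribˡ-xor (f i) (g (n ∸ i)) (h (n ∸ i))))
        (xsum-xor n (λ i → f i ∧ g (n ∸ i)) (λ i → f i ∧ h (n ∸ i)))

⊛-zeroʳ : ∀ f {g} → g ≗ zeroS → f ⊛ g ≗ zeroS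
⊛-zeroʳ f g≗0 n = xsum-false n _ (λ i _ → trans (cong (f i ∧_) (g≗0 (n ∸ i))) (∧-zeroʳ (f i)))

⊛-identityˡ : ∀ f → oneS ⊛ f ≗ f
⊛-identityˡ f n = xsum-single n _ z≤n others
  where
  others : ∀ i → i ≢ 0 → oneS i ∧ f (n ∸ i) ≡ false
  others zero    i≢0 = ⊥-elim (i≢0 refl)
  others (suc i) _   = refl

⊛-identityʳ : ∀ f → f ⊛ oneS ≗ f
⊛-identityʳ f n = trans (⊛-comm f oneS n) (⊛-identityˡ f n)

^S-+ : ∀ g a b → g ^S (a + b) ≗ (g ^S a) ⊛ (g ^S b)
^S-+ g zero    b n = sym (⊛-identityˡ (g ^S b) n)
^S-+ g (suc a) b n =
  trans (⊛-cong {g} (λ _ → refl) (^S-+ g a b) n) (sym (⊛-assoc g (g ^S a) (g ^S b) n))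

^S-cong : ∀ {f f′} → f ≗ f′ → ∀ k → f ^S k ≗ f′ ^S k
^S-cong f≗f′ zero    = λ _ → refl
^S-cong f≗f′ (suc k) = ⊛-cong f≗f′ (^S-cong f≗f′ k)

^S-order : ∀ {g} → g 0 ≡ false → ∀ k m → m < k → (g ^S k) m ≡ false
^S-order {g} g0 (suc k) m m<1+k = xsum-false m _ vanish
  where
  vanish : ∀ i → i ≤ m → g i ∧ (g ^S k) (m ∸ i) ≡ false
  vanish zero    _   = cong (_∧ (g ^S k) m) g0
  vanish (suc i) i<m =
    trans (cong (g (suc i) ∧_) (^S-order g0 k (m ∸ suc i)
                                  (<-≤-trans (∸-monoʳ-< {m} {suc i} {0} (s≤s z≤n) i<m) (≤-pred m<1+k))))
          (∧-zeroʳ _)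

X-⊛ : ∀ h n → (Xs ⊛ h) (suc n) ≡ h n
X-⊛ h n = xsum-single (suc n) _ (s≤s z≤n) others
  where
  others : ∀ i → i ≢ 1 → Xs i ∧ h (suc n ∸ i) ≡ false
  others zero          _   = refl
  others (suc zero)    i≢1 = ⊥-elim (i≢1 refl)
  others (suc (suc i)) _   = refl

⊛-X : ∀ f n → (f ⊛ Xs) (suc n) ≡ f n
⊛-X f n = trans (⊛-comm f Xs (suc n)) (X-⊛ f n)

X^k-⊛ : ∀ k h n → ((Xs ^S k) ⊛ h) (k + n) ≡ h n
X^k-⊛ zero    h n = ⊛-identityˡ h n
X^k-⊛ (suc k) h n =
  trans (⊛-assoc Xs (Xs ^S k) h (suc (k + n))) (trans (X-⊛ ((Xs ^S k) ⊛ h) (k + n)) (X^k-⊛ k h n))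

⊛-X^k : ∀ k f n → (f ⊛ (Xs ^S k)) (k + n) ≡ f n
⊛-X^k k f n = trans (⊛-comm f (Xs ^S k) (k + n)) (X^k-⊛ k f n)

X^k-⊛-low : ∀ k h m → m < k → ((Xs ^S k) ⊛ h) m ≡ false
X^k-⊛-low k h m m<k =
  xsum-false m _ (λ i i≤m → cong (_∧ h (m ∸ i)) (^S-order refl k i (≤-<-trans i≤m m<k)))

-- Frobenius: over F₂, f(X)² = f(X²) and hence f(X)⁴ = f(X⁴).

-- In the coefficient 2 + N of f², the two outer terms f₀f_{N+2} cancel.
⊛-square-shift : ∀ N f → (f ⊛ f) (2 + N) ≡ ((λ i → f (suc i)) ⊛ (λ i → f (suc i))) N
⊛-square-shift N f = begin
    xsum (suc N) term xor term (2 + N)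
  ≡⟨ cong₂ _xor_ (xsum-unfoldˡ N term) (cong (λ z → f (2 + N) ∧ f z) (n∸n≡0 N)) ⟩
    (term 0 xor xsum N (λ i → term (suc i))) xor (f (2 + N) ∧ f 0)
  ≡⟨ outer-cancel (f 0) (f (2 + N)) _ ⟩
    xsum N (λ i → term (suc i))
  ≡⟨ xsum-cong-≤ N (λ i i≤N → cong (λ z → f (suc i) ∧ f z) (+-∸-assoc 1 i≤N)) ⟩
    ((λ i → f (suc i)) ⊛ (λ i → f (suc i))) N
  ∎
  where
  open ≡-Reasoning
  term : ℕ → Bool
  term i = f i ∧ f (2 + N ∸ i)
  outer-cancel : ∀ x y s → ((x ∧ y) xor s) xor (y ∧ x) ≡ s
  outer-cancel true  true  true  = refl
  outer-cancel true  true  false = refl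
  outer-cancel true  false s     = xor-identityʳ s
  outer-cancel false y     s     = trans (cong (s xor_) (∧-zeroʳ y)) (xor-identityʳ s)

⊛-square-even : ∀ a f → (f ⊛ f) (2 * a) ≡ f a
⊛-square-even zero    f = ∧-idem (f 0)
⊛-square-even (suc a) f =
  trans (cong (f ⊛ f) (*-suc 2 a))
        (trans (⊛-square-shift (2 * a) f) (⊛-square-even a (λ i → f (suc i))))

⊛-square-odd : ∀ a f → (f ⊛ f) (1 + 2 * a) ≡ false
⊛-square-odd zero    f = trans (cong ((f 0 ∧ f 1) xor_) (∧-comm (f 1) (f 0))) (xor-same (f 0 ∧ f 1))
⊛-square-odd (suc a) f =
  trans (cong (λ z → (f ⊛ f) (1 + z)) (*-suc 2 a))
        (trans (⊛-square-shift (1 + 2 * a) f) (⊛-square-odd a (λ i → f (suc i))))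

^2-even : ∀ f a → (f ^S 2) (2 * a) ≡ f a
^2-even f a = trans (⊛-cong {f} (λ _ → refl) (⊛-identityʳ f) (2 * a)) (⊛-square-even a f)

^2-odd : ∀ f a → (f ^S 2) (1 + 2 * a) ≡ false
^2-odd f a = trans (⊛-cong {f} (λ _ → refl) (⊛-identityʳ f) (1 + 2 * a)) (⊛-square-odd a f)

^4-at-4a : ∀ f a → (f ^S 4) (4 * a) ≡ f a
^4-at-4a f a = begin
    (f ^S 4) (4 * a)                  ≡⟨ ^S-+ f 2 2 (4 * a) ⟩
    ((f ^S 2) ⊛ (f ^S 2)) (4 * a)       ≡⟨ cong ((f ^S 2) ⊛ (f ^S 2)) (*-assoc 2 2 a) ⟩
    ((f ^S 2) ⊛ (f ^S 2)) (2 * (2 * a)) ≡⟨ ⊛-square-even (2 * a) (f ^S 2) ⟩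
    (f ^S 2) (2 * a)                  ≡⟨ ^2-even f a ⟩
    f a                               ∎
  where open ≡-Reasoning

^4-at-odd : ∀ f a → (f ^S 4) (1 + 2 * a) ≡ false
^4-at-odd f a = trans (^S-+ f 2 2 (1 + 2 * a)) (⊛-square-odd a (f ^S 2))

^4-at-4a+2 : ∀ f a → (f ^S 4) (2 + 4 * a) ≡ false
^4-at-4a+2 f a = begin
    (f ^S 4) (2 + 4 * a)                  ≡⟨ ^S-+ f 2 2 (2 + 4 * a) ⟩
    ((f ^S 2) ⊛ (f ^S 2)) (2 + 4 * a)       ≡⟨ cong ((f ^S 2) ⊛ (f ^S 2)) (index a) ⟩
    ((f ^S 2) ⊛ (f ^S 2)) (2 * (1 + 2 * a)) ≡⟨ ⊛-square-even (1 + 2 * a) (f ^S 2) ⟩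
    (f ^S 2) (1 + 2 * a)                  ≡⟨ ^2-odd f a ⟩
    false                                 ∎
  where
  open ≡-Reasoning
  index : ∀ a → 2 + 4 * a ≡ 2 * (1 + 2 * a)
  index = solve-∀

-- Composition with a series g without constant term is a ring homomorphism f ↦ f ∘ g.

-- Since gᵏ has order ≥ k, the sum defining (f ∘ g)ₘ may run up to any bound N ≥ m.
∘S-bound : ∀ f {g} → g 0 ≡ false → ∀ {m N} → m ≤ N →
  (f ∘S g) m ≡ xsum N (λ k → f k ∧ (g ^S k) m)
∘S-bound f g0 m≤N =
  sym (xsum-extend _ m≤N (λ k m<k → trans (cong (f k ∧_) (^S-order g0 k _ m<k)) (∧-zeroʳ _)))

∘S-⊕ : ∀ f h g → (f ⊕ h) ∘S g ≗ (f ∘S g) ⊕ (h ∘S g)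
∘S-⊕ f h g m =
  trans (xsum-cong m (λ k → ∧-distribʳ-xor ((g ^S k) m) (f k) (h k)))
        (xsum-xor m (λ k → f k ∧ (g ^S k) m) (λ k → h k ∧ (g ^S k) m))

∘S-zero : ∀ {f} g → f ≗ zeroS → f ∘S g ≗ zeroS
∘S-zero g f≗0 m = xsum-false m _ (λ k _ → cong (_∧ (g ^S k) m) (f≗0 k))

⊛-bilinear : ∀ N (f h : ℕ → Bool) (A B : ℕ → Series) m →
  ((λ j → xsum N (λ i → f i ∧ A i j)) ⊛ (λ j → xsum N (λ l → h l ∧ B l j))) m
  ≡ xsum N (λ i → xsum N (λ l → (f i ∧ h l) ∧ (A i ⊛ B l) m))
⊛-bilinear N f h A B m = begin
    xsum m (λ j → xsum N (λ i → f i ∧ A i j) ∧ xsum N (λ l → h l ∧ B l (m ∸ j)))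
  ≡⟨ xsum-cong m (λ j → trans (xsum-∧ʳ N _ (λ i → f i ∧ A i j))
                              (xsum-cong N (λ i → xsum-∧ˡ N (f i ∧ A i j) (λ l → h l ∧ B l (m ∸ j))))) ⟩
    xsum m (λ j → xsum N (λ i → xsum N (λ l → term i l j)))
  ≡⟨ xsum-swap m N (λ j i → xsum N (λ l → term i l j)) ⟩
    xsum N (λ i → xsum m (λ j → xsum N (λ l → term i l j)))
  ≡⟨ xsum-cong N (λ i → xsum-swap m N (λ j l → term i l j)) ⟩
    xsum N (λ i → xsum N (λ l → xsum m (term i l)))
  ≡⟨ xsum-cong N (λ i → xsum-cong N (λ l →
       trans (xsum-cong m (λ j → ∧-interchange (f i) (A i j) (h l) (B l (m ∸ j))))
             (sym (xsum-∧ˡ m (f i ∧ h l) (λ j → A i j ∧ B l (m ∸ j)))))) ⟩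
    xsum N (λ i → xsum N (λ l → (f i ∧ h l) ∧ (A i ⊛ B l) m))
  ∎
  where
  open ≡-Reasoning
  term : ℕ → ℕ → ℕ → Bool
  term i l j = (f i ∧ A i j) ∧ (h l ∧ B l (m ∸ j))

-- ((f h) ∘ g)ₘ = Σᵢ Σₗ fᵢhₗ [gⁱgˡ]ₘ, collecting the terms of gᵏ = gⁱgᵏ⁻ⁱ.
∘S-⊛-expand : ∀ f h {g} → g 0 ≡ false → ∀ m →
  ((f ⊛ h) ∘S g) m ≡ xsum m (λ i → xsum m (λ l → (f i ∧ h l) ∧ ((g ^S i) ⊛ (g ^S l)) m))
∘S-⊛-expand f h {g} g0 m = begin
    xsum m (λ k → (f ⊛ h) k ∧ (g ^S k) m)
  ≡⟨ xsum-cong m (λ k → xsum-∧ʳ k ((g ^S k) m) (λ i → f i ∧ h (k ∸ i))) ⟩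
    xsum m (λ k → xsum k (λ i → (f i ∧ h (k ∸ i)) ∧ (g ^S k) m))
  ≡⟨ xsum-cong m (λ k → xsum-cong-≤ k (λ i i≤k → cong ((f i ∧ h (k ∸ i)) ∧_)
       (trans (cong (λ z → (g ^S z) m) (sym (m+[n∸m]≡n i≤k))) (^S-+ g i (k ∸ i) m)))) ⟩
    xsum m (λ k → xsum k (λ i → term i (k ∸ i)))
  ≡⟨ xsum-triangle m term ⟩
    xsum m (λ i → xsum (m ∸ i) (term i))
  ≡⟨ xsum-cong-≤ m (λ i i≤m → sym (xsum-extend (term i) (m∸n≤m m i) (vanish i≤m))) ⟩
    xsum m (λ i → xsum m (term i))
  ∎
  where
  open ≡-Reasoning
  term : ℕ → ℕ → Bool
  term i l = (f i ∧ h l) ∧ ((g ^S i) ⊛ (g ^S l)) m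
  -- gⁱgˡ = gⁱ⁺ˡ has no coefficient below i + l.
  vanish : ∀ {i} → i ≤ m → ∀ l → m ∸ i < l → term i l ≡ false
  vanish {i} i≤m l m∸i<l = trans (cong ((f i ∧ h l) ∧_)
    (trans (sym (^S-+ g i l m)) (^S-order g0 (i + l) m
      (subst (_< i + l) (m+[n∸m]≡n i≤m) (+-monoʳ-< i m∸i<l))))) (∧-zeroʳ _)

∘S-⊛ : ∀ f h {g} → g 0 ≡ false → (f ⊛ h) ∘S g ≗ (f ∘S g) ⊛ (h ∘S g)
∘S-⊛ f h {g} g0 m =
  trans (∘S-⊛-expand f h g0 m)
        (trans (sym (⊛-bilinear m f h (g ^S_) (g ^S_) m))
               (⊛-cong-≤ m (λ j j≤m → sym (∘S-bound f {g} g0 j≤m))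
                                 (λ j j≤m → sym (∘S-bound h {g} g0 j≤m))))

oneS-∘S : ∀ g → oneS ∘S g ≗ oneS
oneS-∘S g m = xsum-single m _ z≤n others
  where
  others : ∀ k → k ≢ 0 → oneS k ∧ (g ^S k) m ≡ false
  others zero    k≢0 = ⊥-elim (k≢0 refl)
  others (suc k) _   = refl

∘S-^S : ∀ f {g} → g 0 ≡ false → ∀ k → (f ^S k) ∘S g ≗ (f ∘S g) ^S k
∘S-^S f {g} g0 zero    = oneS-∘S g
∘S-^S f {g} g0 (suc k) m =
  trans (∘S-⊛ f (f ^S k) g0 m) (⊛-cong {f ∘S g} (λ _ → refl) (∘S-^S f g0 k) m)

X-∘S : ∀ {g} → g 0 ≡ false → Xs ∘S g ≗ g
X-∘S g0 zero          = sym g0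
X-∘S {g} g0 (suc m) = trans (xsum-single (suc m) _ (s≤s z≤n) others) (⊛-identityʳ g (suc m))
  where
  others : ∀ k → k ≢ 1 → Xs k ∧ (g ^S k) (suc m) ≡ false
  others zero          _   = refl
  others (suc zero)    k≢1 = ⊥-elim (k≢1 refl)
  others (suc (suc k)) _   = refl

data EvenOrOdd : ℕ → Set where
  even : ∀ k → EvenOrOdd (2 * k)
  odd  : ∀ k → EvenOrOdd (1 + 2 * k)

evenOrOdd : ∀ n → EvenOrOdd n
evenOrOdd zero = even 0
evenOrOdd (suc n) with evenOrOdd n
... | even k = odd k
... | odd k  = subst EvenOrOdd (*-suc 2 k) (even (suc k))

%2-even : ∀ c → (2 * c) % 2 ≡ 0
%2-even c = trans (cong (_% 2) (*-comm 2 c)) (m*n%n≡0 c 2)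

/2-even : ∀ c → (2 * c) / 2 ≡ c
/2-even c = trans (cong (_/ 2) (*-comm 2 c)) (m*n/n≡m c 2)

%2-odd : ∀ c → (1 + 2 * c) % 2 ≡ 1
%2-odd c = trans (cong (λ z → (1 + z) % 2) (*-comm 2 c)) ([m+kn]%n≡m%n 1 c 2)

/2-odd : ∀ c → (1 + 2 * c) / 2 ≡ c
/2-odd c = trans (cong (λ z → (1 + z) / 2) (*-comm 2 c)) (trans (+-distrib-/ 1 (c * 2) no-carry) (m*n/n≡m c 2))
  where
  no-carry : 1 % 2 + (c * 2) % 2 < 2
  no-carry = subst (λ r → 1 + r < 2) (sym (m*n%n≡0 c 2)) (s≤s (s≤s z≤n))

bitsF-fuel : ∀ f g m → m ≤ f → m ≤ g → bitsF f m ≡ bitsF g m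
bitsF-fuel zero    zero    m       _       _       = refl
bitsF-fuel zero    (suc g) zero    _       _       = refl
bitsF-fuel (suc f) zero    zero    _       _       = refl
bitsF-fuel (suc f) (suc g) zero    _       _       = refl
bitsF-fuel (suc f) (suc g) (suc m) (s≤s m≤f) (s≤s m≤g) =
  cong (_ ∷_) (bitsF-fuel f g (suc m / 2) (≤-trans half≤m m≤f) (≤-trans half≤m m≤g))
  where
  half≤m : suc m / 2 ≤ m
  half≤m = ≤-pred (m/n<m (suc m) 2 (s≤s (s≤s z≤n)))

bits-odd : ∀ c → bits (1 + 2 * c) ≡ true ∷ bits c
bits-odd c = cong₂ _∷_ (cong (_≡ᵇ 1) (%2-odd c))
  (trans (cong (bitsF (2 * c)) (/2-odd c)) (bitsF-fuel (2 * c) c c (m≤m+n c _) ≤-refl))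

bits-double : ∀ c → 0 < c → bits (2 * c) ≡ false ∷ bits c
bits-double (suc c) _ = cong₂ _∷_ (cong (_≡ᵇ 1) (%2-even (suc c)))
  (trans (cong (bitsF _) (/2-even (suc c))) (bitsF-fuel _ (suc c) (suc c) (≤-pred (m<m+n (suc c) z<s)) ≤-refl))

zeroBlocks-two-more : ∀ k ds → any isOdd (zeroBlocksFrom (2 + k) ds) ≡ any isOdd (zeroBlocksFrom k ds)
zeroBlocks-two-more zero    []           = refl
zeroBlocks-two-more (suc k) []           = refl
zeroBlocks-two-more zero    (false ∷ ds) = zeroBlocks-two-more 1 ds
zeroBlocks-two-more (suc k) (false ∷ ds) = zeroBlocks-two-more (2 + k) ds
zeroBlocks-two-more zero    (true ∷ ds)  = refl
zeroBlocks-two-more (suc k) (true ∷ ds)  = refl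

baumSweet-odd : ∀ c → baumSweet (1 + 2 * c) ≡ baumSweet c
baumSweet-odd zero    = refl
baumSweet-odd (suc c) = cong (λ ds → not (any isOdd (zeroBlocks ds))) (bits-odd (suc c))

baumSweet-4p : ∀ p → baumSweet (4 * p) ≡ baumSweet p
baumSweet-4p zero    = refl
baumSweet-4p (suc p) =
  trans (cong (λ ds → not (any isOdd (zeroBlocks ds))) digits)
        (cong not (zeroBlocks-two-more 0 (bits (suc p))))
  where
  digits : bits (4 * suc p) ≡ false ∷ false ∷ bits (suc p)
  digits = trans (cong bits (*-assoc 2 2 (suc p)))
                 (trans (bits-double (2 * suc p) z<s) (cong (false ∷_) (bits-double (suc p) z<s)))

baumSweet-4p+2 : ∀ p → baumSweet (2 + 4 * p) ≡ false
baumSweet-4p+2 p = cong (λ ds → not (any isOdd (zeroBlocks ds))) digits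
  where
  index : ∀ p → 2 + 4 * p ≡ 2 * (1 + 2 * p)
  index = solve-∀
  digits : bits (2 + 4 * p) ≡ false ∷ true ∷ bits p
  digits = trans (cong bits (index p)) (trans (bits-double (1 + 2 * p) z<s) (cong (false ∷_) (bits-odd p)))

D-double : ∀ c → D (2 * c) ≡ D c
D-double zero    = refl
D-double (suc c) = trans (cong D (*-suc 2 c)) (baumSweet-odd c)

-- The algebraic equation X³D + X³D² + D⁴ = 0 satisfied by D.

E : Series
E = ((Xs ^S 3) ⊛ D) ⊕ (((Xs ^S 3) ⊛ (D ^S 2)) ⊕ (D ^S 4))

E-shift : ∀ n → E (3 + n) ≡ D n xor ((D ^S 2) n xor (D ^S 4) (3 + n))
E-shift n = cong₂ _xor_ (X^k-⊛ 3 D n) (cong₂ _xor_ (X^k-⊛ 3 (D ^S 2) n) refl)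

D-equation : E ≗ zeroS
D-equation 0 = cong₂ _xor_ (X^k-⊛-low 3 D 0 z<s)
                           (cong₂ _xor_ (X^k-⊛-low 3 (D ^S 2) 0 z<s) (^4-at-4a D 0))
D-equation 1 = cong₂ _xor_ (X^k-⊛-low 3 D 1 (s≤s z<s))
                           (cong₂ _xor_ (X^k-⊛-low 3 (D ^S 2) 1 (s≤s z<s)) (^4-at-odd D 0))
D-equation 2 = cong₂ _xor_ (X^k-⊛-low 3 D 2 (s≤s (s≤s z<s)))
                           (cong₂ _xor_ (X^k-⊛-low 3 (D ^S 2) 2 (s≤s (s≤s z<s))) (^4-at-4a+2 D 0))
D-equation (suc (suc (suc n))) with evenOrOdd n
... | even c = begin
    E (3 + 2 * c)
  ≡⟨ E-shift (2 * c) ⟩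
    D (2 * c) xor ((D ^S 2) (2 * c) xor (D ^S 4) (3 + 2 * c))
  ≡⟨ cong₂ _xor_ (D-double c) (cong₂ _xor_ (^2-even D c)
       (trans (cong (D ^S 4) (index-odd c)) (^4-at-odd D (1 + c)))) ⟩
    D c xor (D c xor false)
  ≡⟨ trans (cong (D c xor_) (xor-identityʳ (D c))) (xor-same (D c)) ⟩
    false
  ∎
  where
  open ≡-Reasoning
  index-odd : ∀ c → 3 + 2 * c ≡ 1 + 2 * (1 + c)
  index-odd = solve-∀
... | odd c with evenOrOdd c
-- n = 1 + 4p: b₄ₚ + 0 + bₚ = 0.
...   | even p = begin
    E (3 + n)
  ≡⟨ E-shift n ⟩
    D n xor ((D ^S 2) n xor (D ^S 4) (3 + n))
  ≡⟨ cong₂ _xor_ (trans (cong baumSweet (sym (*-assoc 2 2 p))) (baumSweet-4p p))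
                 (cong₂ _xor_ (^2-odd D (2 * p))
                              (trans (cong (D ^S 4) (index-4 p)) (^4-at-4a D (1 + p)))) ⟩
    baumSweet p xor (false xor baumSweet p)
  ≡⟨ xor-same (baumSweet p) ⟩
    false
  ∎
  where
  open ≡-Reasoning
  index-4 : ∀ p → 4 + 2 * (2 * p) ≡ 4 * (1 + p)
  index-4 = solve-∀
-- n = 3 + 4p: b₄ₚ₊₂ + 0 + 0 = 0.
...   | odd p =
  trans (E-shift n)
        (cong₂ _xor_ (trans (cong baumSweet (index-2 p)) (baumSweet-4p+2 p))
                     (cong₂ _xor_ (^2-odd D (1 + 2 * p))
                                  (trans (cong (D ^S 4) (index-6 p)) (^4-at-4a+2 D (1 + p)))))
  where
  index-2 : ∀ p → 2 * (1 + 2 * p) ≡ 2 + 4 * p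
  index-2 = solve-∀
  index-6 : ∀ p → 4 + 2 * (1 + 2 * p) ≡ 2 + 4 * (1 + p)
  index-6 = solve-∀

binary-induction : (P : ℕ → Set) → P 0 → (∀ a → P a → P (2 * a)) → (∀ a → P a → P (1 + 2 * a)) →
  ∀ n → P n
binary-induction P base step-even step-odd = <-rec P step
  where
  step : ∀ n → (∀ {k} → k < n → P k) → P n
  step n ih with evenOrOdd n
  ... | even zero    = base
  ... | even (suc a) = step-even (suc a) (ih (m<m+n (suc a) z<s))
  ... | odd a        = step-odd a (ih (s≤s (m≤m+n a _)))

data Mod4 : ℕ → Set where
  rem0 : ∀ k → Mod4 (4 * k)
  rem1 : ∀ k → Mod4 (1 + 4 * k)
  rem2 : ∀ k → Mod4 (2 + 4 * k)
  rem3 : ∀ k → Mod4 (3 + 4 * k)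

mod4 : ∀ n → Mod4 n
mod4 zero = rem0 0
mod4 (suc n) with mod4 n
... | rem0 k = rem1 k
... | rem1 k = rem2 k
... | rem2 k = rem3 k
... | rem3 k = subst Mod4 (*-suc 4 k) (rem0 (suc k))

digit : Bool → ℕ
digit false = 0
digit true  = 1

fromBase4 : List Bool → ℕ
fromBase4 []       = 0
fromBase4 (d ∷ ds) = digit d + 4 * fromBase4 ds

-- The binary digits of n read in base 4; its image is the set of numbers with base-4 digits in {0, 1}.
asBase4 : ℕ → ℕ
asBase4 n = fromBase4 (bits n)

asBase4-even : ∀ n → asBase4 (2 * n) ≡ 4 * asBase4 n
asBase4-even zero    = refl
asBase4-even (suc n) = cong fromBase4 (bits-double (suc n) z<s)

asBase4-odd : ∀ n → asBase4 (1 + 2 * n) ≡ 1 + 4 * asBase4 n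
asBase4-odd n = cong fromBase4 (bits-odd n)

-- asBase4 is strictly increasing: 2a ↦ 2a + 1 adds 1, and 2a + 1 ↦ 2a + 2 gains at least 3.
asBase4-increasing : ∀ n → asBase4 n < asBase4 (suc n)
asBase4-increasing = binary-induction (λ n → asBase4 n < asBase4 (suc n)) z<s
  (λ a _ → subst₂ _<_ (sym (asBase4-even a)) (sym (asBase4-odd a)) (n<1+n _))
  (λ a ih → begin-strict
    asBase4 (1 + 2 * a)   ≡⟨ asBase4-odd a ⟩
    1 + 4 * asBase4 a     <⟨ +-monoˡ-< (4 * asBase4 a) {1} {4} (s≤s (s≤s z≤n)) ⟩
    4 + 4 * asBase4 a     ≡⟨ sym (*-suc 4 (asBase4 a)) ⟩
    4 * suc (asBase4 a)   ≤⟨ *-monoʳ-≤ 4 ih ⟩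
    4 * asBase4 (suc a)   ≡⟨ sym (asBase4-even (suc a)) ⟩
    asBase4 (2 * suc a)   ≡⟨ cong asBase4 (*-suc 2 a) ⟩
    asBase4 (2 + 2 * a)   ∎)
  where open ≤-Reasoning

-- The recurrence characterising the indicator of the image of asBase4.
record Base4Recurrence (s : ℕ → Bool) : Set where
  field
    at-0    : s 0 ≡ true
    at-4k   : ∀ k → s (4 * k) ≡ s k
    at-4k+1 : ∀ k → s (1 + 4 * k) ≡ s k
    at-4k+2 : ∀ k → s (2 + 4 * k) ≡ false
    at-4k+3 : ∀ k → s (3 + 4 * k) ≡ false

false≢true : false ≢ true
false≢true ()

module _ {s : ℕ → Bool} (recurrence : Base4Recurrence s) where
  open Base4Recurrence recurrence

  base4-complete : ∀ n → s (asBase4 n) ≡ true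
  base4-complete = binary-induction (λ n → s (asBase4 n) ≡ true) at-0
    (λ a ih → trans (cong s (asBase4-even a)) (trans (at-4k (asBase4 a)) ih))
    (λ a ih → trans (cong s (asBase4-odd a)) (trans (at-4k+1 (asBase4 a)) ih))

  base4-sound : ∀ j → s j ≡ true → ∃ λ n → asBase4 n ≡ j
  base4-sound = <-rec (λ j → s j ≡ true → ∃ λ n → asBase4 n ≡ j) step
    where
    step : ∀ j → (∀ {k} → k < j → s k ≡ true → ∃ λ n → asBase4 n ≡ k) →
      s j ≡ true → ∃ λ n → asBase4 n ≡ j
    step j ih sj with mod4 j
    ... | rem0 zero    = 0 , refl
    ... | rem0 (suc k) with ih (m<m+n (suc k) z<s) (trans (sym (at-4k (suc k))) sj)
    ...   | n , tn≡k = 2 * n , trans (asBase4-even n) (cong (4 *_) tn≡k)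
    step j ih sj | rem1 k with ih (s≤s (m≤n*m k 4)) (trans (sym (at-4k+1 k)) sj)
    ...   | n , tn≡k = 1 + 2 * n , trans (asBase4-odd n) (cong (λ z → 1 + 4 * z) tn≡k)
    step j ih sj | rem2 k = ⊥-elim (false≢true (trans (sym (at-4k+2 k)) sj))
    step j ih sj | rem3 k = ⊥-elim (false≢true (trans (sym (at-4k+3 k)) sj))

  base4-support : ∀ j → (s j ≡ true) ⇔ (∃ λ n → asBase4 n ≡ j)
  base4-support j = mk⇔ (base4-sound j) (λ { (n , refl) → base4-complete n })

-- The composition inverse Q satisfies a linear recurrence.

xor-solve : ∀ x y z → x xor (y xor z) ≡ false → z ≡ x xor y
xor-solve true  true  true  ()
xor-solve true  true  false _  = refl
xor-solve true  false true  _  = refl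
xor-solve true  false false ()
xor-solve false true  true  _  = refl
xor-solve false true  false ()
xor-solve false false true  ()
xor-solve false false false _  = refl

module InverseOfD (Q : Series) (Q0 : Q 0 ≡ false) (DQ : D ∘S Q ≗ Xs) where

  -- Substituting Q into the equation of D gives Q³X + Q³X² + X⁴ = 0.
  R : Series
  R = ((Q ^S 3) ⊛ Xs) ⊕ (((Q ^S 3) ⊛ (Xs ^S 2)) ⊕ (Xs ^S 4))

  R≗0 : R ≗ zeroS
  R≗0 m = trans (sym E∘Q) (∘S-zero Q D-equation m)
    where
    X³∘Q : (Xs ^S 3) ∘S Q ≗ Q ^S 3
    X³∘Q n = trans (∘S-^S Xs Q0 3 n) (^S-cong (X-∘S Q0) 3 n)
    Dᵏ∘Q : ∀ k → (D ^S k) ∘S Q ≗ Xs ^S k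
    Dᵏ∘Q k n = trans (∘S-^S D Q0 k n) (^S-cong DQ k n)
    E∘Q : (E ∘S Q) m ≡ R m
    E∘Q = trans (∘S-⊕ ((Xs ^S 3) ⊛ D) (((Xs ^S 3) ⊛ (D ^S 2)) ⊕ (D ^S 4)) Q m) (cong₂ _xor_
      (trans (∘S-⊛ (Xs ^S 3) D Q0 m) (⊛-cong X³∘Q DQ m))
      (trans (∘S-⊕ ((Xs ^S 3) ⊛ (D ^S 2)) (D ^S 4) Q m) (cong₂ _xor_
        (trans (∘S-⊛ (Xs ^S 3) (D ^S 2) Q0 m) (⊛-cong X³∘Q (Dᵏ∘Q 2) m))
        (Dᵏ∘Q 4 m))))

  -- Multiplying by Q gives Q⁴X + Q⁴X² + QX⁴ = 0, i.e. Qₙ = [Q⁴]ₙ₊₃ + [Q⁴]ₙ₊₂.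
  Q-recurrence : ∀ n → Q n ≡ (Q ^S 4) (3 + n) xor (Q ^S 4) (2 + n)
  Q-recurrence n = xor-solve ((Q ^S 4) (3 + n)) ((Q ^S 4) (2 + n)) (Q n)
                             (trans (sym QR-coefficient) (⊛-zeroʳ Q R≗0 (4 + n)))
    where
    Q⁴Xᵏ : ∀ k j → (Q ⊛ ((Q ^S 3) ⊛ (Xs ^S k))) (k + j) ≡ (Q ^S 4) j
    Q⁴Xᵏ k j = trans (sym (⊛-assoc Q (Q ^S 3) (Xs ^S k) (k + j))) (⊛-X^k k (Q ^S 4) j)
    QR-coefficient : (Q ⊛ R) (4 + n) ≡ (Q ^S 4) (3 + n) xor ((Q ^S 4) (2 + n) xor Q n)
    QR-coefficient =
      trans (⊛-distribˡ-⊕ Q ((Q ^S 3) ⊛ Xs) (((Q ^S 3) ⊛ (Xs ^S 2)) ⊕ (Xs ^S 4)) (4 + n)) (cong₂ _xor_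
        (trans (sym (⊛-assoc Q (Q ^S 3) Xs (4 + n))) (⊛-X (Q ^S 4) (3 + n)))
        (trans (⊛-distribˡ-⊕ Q ((Q ^S 3) ⊛ (Xs ^S 2)) (Xs ^S 4) (4 + n))
               (cong₂ _xor_ (Q⁴Xᵏ 2 (2 + n)) (⊛-X^k 4 Q n))))

  -- Frobenius turns the recurrence into one relating Qₘ to Q at about m/4.
  Q⁴-at-3+4k : ∀ k → (Q ^S 4) (3 + 4 * k) ≡ false
  Q⁴-at-3+4k k = trans (cong (Q ^S 4) (index k)) (^4-at-odd Q (1 + 2 * k))
    where
    index : ∀ k → 3 + 4 * k ≡ 1 + 2 * (1 + 2 * k)
    index = solve-∀

  Q⁴-at-5+4k : ∀ k → (Q ^S 4) (5 + 4 * k) ≡ false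
  Q⁴-at-5+4k k = trans (cong (Q ^S 4) (index k)) (^4-at-odd Q (2 + 2 * k))
    where
    index : ∀ k → 5 + 4 * k ≡ 1 + 2 * (2 + 2 * k)
    index = solve-∀

  Q⁴-at-4+4k : ∀ k → (Q ^S 4) (4 + 4 * k) ≡ Q (1 + k)
  Q⁴-at-4+4k k = trans (cong (Q ^S 4) (sym (*-suc 4 k))) (^4-at-4a Q (1 + k))

  Q-at-4k : ∀ k → Q (4 * k) ≡ false
  Q-at-4k k = trans (Q-recurrence (4 * k)) (cong₂ _xor_ (Q⁴-at-3+4k k) (^4-at-4a+2 Q k))

  Q-at-1+4k : ∀ k → Q (1 + 4 * k) ≡ Q (1 + k)
  Q-at-1+4k k = trans (Q-recurrence (1 + 4 * k))
    (trans (cong₂ _xor_ (Q⁴-at-4+4k k) (Q⁴-at-3+4k k)) (xor-identityʳ (Q (1 + k))))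

  Q-at-2+4k : ∀ k → Q (2 + 4 * k) ≡ Q (1 + k)
  Q-at-2+4k k = trans (Q-recurrence (2 + 4 * k))
    (cong₂ _xor_ (Q⁴-at-5+4k k) (Q⁴-at-4+4k k))

  Q-at-3+4k : ∀ k → Q (3 + 4 * k) ≡ false
  Q-at-3+4k k = trans (Q-recurrence (3 + 4 * k))
    (cong₂ _xor_ (trans (cong (λ i → (Q ^S 4) (2 + i)) (sym (*-suc 4 k))) (^4-at-4a+2 Q (suc k)))
                 (Q⁴-at-5+4k k))

  Q-shifted-base4 : Base4Recurrence (λ j → Q (suc j))
  Q-shifted-base4 = record
    { at-0    = trans (sym (⊛-identityʳ Q 1)) (DQ 1)
    ; at-4k   = Q-at-1+4k
    ; at-4k+1 = Q-at-2+4k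
    ; at-4k+2 = Q-at-3+4k
    ; at-4k+3 = λ k → trans (cong Q (sym (*-suc 4 k))) (Q-at-4k (suc k))
    }

  Q-support : ∀ m → (Q m ≡ true) ⇔ (∃ λ n → suc (asBase4 n) ≡ m)
  Q-support zero    = mk⇔ (λ Q0≡true → ⊥-elim (false≢true (trans (sym Q0) Q0≡true))) (λ { (_ , ()) })
  Q-support (suc j) = mk⇔
    (λ Q1+j → let (n , tn≡j) = Equivalence.to (base4-support Q-shifted-base4 j) Q1+j in n , cong suc tn≡j)
    (λ { (n , 1+tn≡1+j) → Equivalence.from (base4-support Q-shifted-base4 j) (n , suc-injective 1+tn≡1+j) })

Increasing : (ℕ → ℕ) → Set
Increasing u = ∀ n → u n < u (n + 1)

module _ {u : ℕ → ℕ} (u-inc : Increasing u) where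

  increasing⇒< : ∀ {a b} → a < b → u a < u b
  increasing⇒< {a} {suc b} a<1+b with m≤n⇒m<n∨m≡n (≤-pred a<1+b)
  ... | inj₁ a<b  = <-trans (increasing⇒< a<b) (step b)
    where
    step : ∀ n → u n < u (suc n)
    step n = subst (λ z → u n < u z) (+-comm n 1) (u-inc n)
  ... | inj₂ refl = subst (λ z → u a < u z) (+-comm a 1) (u-inc a)

  increasing⇒≤ : ∀ {a b} → a ≤ b → u a ≤ u b
  increasing⇒≤ a≤b with m≤n⇒m<n∨m≡n a≤b
  ... | inj₁ a<b  = <⇒≤ (increasing⇒< a<b)
  ... | inj₂ refl = ≤-refl

-- If u and v agree below n and the range of u lies in that of v, then vₙ ≤ uₙ:
-- uₙ = vₚ for some p, and p < n would give uₙ = uₚ.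
enumeration-below : ∀ {u v} → Increasing u → Increasing v →
  (∀ m → (∃ λ n → u n ≡ m) → ∃ λ n → v n ≡ m) →
  ∀ n → (∀ {k} → k < n → u k ≡ v k) → v n ≤ u n
enumeration-below {u} {v} u-inc v-inc u⊆v n agree with u⊆v (u n) (n , refl)
... | p , vp≡un with p <? n
...   | yes p<n = ⊥-elim (<-irrefl (trans (agree p<n) vp≡un) (increasing⇒< u-inc p<n))
...   | no p≮n  = subst (v n ≤_) vp≡un (increasing⇒≤ v-inc (≮⇒≥ p≮n))

increasing-enumeration-unique : ∀ {u v} → Increasing u → Increasing v →
  (∀ m → (∃ λ n → u n ≡ m) ⇔ (∃ λ n → v n ≡ m)) → ∀ n → u n ≡ v n
increasing-enumeration-unique {u} {v} u-inc v-inc same-range = <-rec (λ n → u n ≡ v n) step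
  where
  step : ∀ n → (∀ {k} → k < n → u k ≡ v k) → u n ≡ v n
  step n agree = ≤-antisym
    (enumeration-below v-inc u-inc (λ m → Equivalence.from (same-range m)) n (λ k<n → sym (agree k<n)))
    (enumeration-below u-inc v-inc (λ m → Equivalence.to (same-range m)) n agree)

-- The increasing enumeration of the support of Q.
u⋆ : ℕ → ℕ
u⋆ n = suc (asBase4 n)

u⋆-increasing : Increasing u⋆
u⋆-increasing n = s≤s (subst (λ i → asBase4 n < asBase4 i) (+-comm 1 n) (asBase4-increasing n))

-- The recurrences u⋆₂ₙ = 4u⋆ₙ − 3 and u⋆₂ₙ₊₁ = 4u⋆ₙ − 2, stated without subtraction.
u⋆-even : ∀ n → u⋆ (2 * n) + 3 ≡ 4 * u⋆ n
u⋆-even n = trans (cong (λ t → suc t + 3) (asBase4-even n)) (arith (asBase4 n))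
  where
  arith : ∀ x → suc (4 * x) + 3 ≡ 4 * suc x
  arith = solve-∀

u⋆-odd : ∀ n → u⋆ (2 * n + 1) + 2 ≡ 4 * u⋆ n
u⋆-odd n = trans (cong (λ i → u⋆ i + 2) (+-comm (2 * n) 1))
                 (trans (cong (λ t → suc t + 2) (asBase4-odd n)) (arith (asBase4 n)))
  where
  arith : ∀ x → suc (1 + 4 * x) + 2 ≡ 4 * suc x
  arith = solve-∀

mainTheorem9 : (Q : Series) → IsCompInverseOfD Q →
    (∃ λ (u : ℕ → ℕ) → (∀ n → u n < u (n + 1)) × (∀ m → (Q m ≡ true) ⇔ (∃ λ n → u n ≡ m)))
    × ((u : ℕ → ℕ) → (∀ n → u n < u (n + 1)) → (∀ m → (Q m ≡ true) ⇔ (∃ λ n → u n ≡ m)) →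
        (u 0 ≡ 1) × (∀ n → (u (2 * n) + 3 ≡ 4 * u n) × (u (2 * n + 1) + 2 ≡ 4 * u n)))
mainTheorem9 Q (Q0 , DQ , _) = (u⋆ , u⋆-increasing , Q-support) , recurrences
  where
  open InverseOfD Q Q0 DQ
  recurrences : (u : ℕ → ℕ) → Increasing u → (∀ m → (Q m ≡ true) ⇔ (∃ λ n → u n ≡ m)) →
    (u 0 ≡ 1) × (∀ n → (u (2 * n) + 3 ≡ 4 * u n) × (u (2 * n + 1) + 2 ≡ 4 * u n))
  recurrences u u-inc u-support = u≡u⋆ 0 , λ n →
      trans (cong (_+ 3) (u≡u⋆ (2 * n))) (trans (u⋆-even n) (cong (4 *_) (sym (u≡u⋆ n))))
    , trans (cong (_+ 2) (u≡u⋆ (2 * n + 1))) (trans (u⋆-odd n) (cong (4 *_) (sym (u≡u⋆ n))))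
    where
    u≡u⋆ : ∀ n → u n ≡ u⋆ n
    u≡u⋆ = increasing-enumeration-unique u-inc u⋆-increasing (λ m → Q-support m ⇔-∘ ⇔-sym (u-support m))
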